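{- For every integer $b\ge0$, let $\mathcal{P}(b)$ be the set of unordered integer partitions of $b$ and for $q\in\mathcal{P}(b)$ let $o(q)$ be the number of parts of $q$ equal to $1$. Then \[ \operatorname{tr}(A_b)=\sum_{q\in\mathcal{P}(b)}2^{o(q)}. \]
   Context: An ordered partition (composition) of a positive integer $b$ is a finite sequence of positive integers with sum $b$. For ordered partitions $q=(q_1,\ldots,q_k)$, $r=(r_1,\ldots,r_\ell)$ of $b$, a nontrivial embedding of $q$ into $r$ is a choice of indices $1\le i_2<\cdots<i_k\le\ell$ with $q_j\le r_{i_j}$ for $2\le j\le k$ (when $k=1$ there is exactly one, the empty choice). For $b\ge1$, $A_b$ is the matrix indexed by ordered partitions of $b$ whose $(q,r)$ entry is the number of nontrivial embeddings of $q$ into $r$ plus $1$ if $q=r$. By convention $A_0=(1)$, and $\mathcal{P}(0)$ consists of the empty partition. -}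

module Defs where

open import Data.Nat using (ℕ; zero; suc; _+_; _∸_; _^_; _≤ᵇ_; _≥_; _≟_)
open import Data.Nat using (_≤?_)
open import Data.Bool using (Bool; true; false; if_then_else_)
open import Data.List using (List; []; _∷_; map; concatMap; length; filter; _++_)
open import Data.Nat.ListAction using (sum)
open import Data.List.Relation.Unary.Linked using (Linked; linked?)
open import Data.List.Properties using (≡-dec)
open import Relation.Nullary.Decidable using (⌊_⌋)

oneTo : ℕ → List ℕ
oneTo zero    = []
oneTo (suc n) = oneTo n ++ (suc n ∷ [])

-- compositionsF fuel b : all ordered partitions of b whose number of parts
-- is at most fuel (fuel = b suffices, since every part is ≥ 1).
compositionsF : ℕ → ℕ → List (List ℕ)
compositionsF _        zero    = [] ∷ []
compositionsF zero     (suc _) = []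
compositionsF (suc f)  b@(suc _) =
  concatMap (λ k → map (k ∷_) (compositionsF f (b ∸ k))) (oneTo b)

compositions : ℕ → List (List ℕ)
compositions b = compositionsF b b

-- Unordered partitions of b, represented canonically as the
-- weakly decreasing compositions of b.
partitions : ℕ → List (List ℕ)
partitions b = filter (linked? (λ x y → y ≤? x)) (compositions b)

ones : List ℕ → ℕ
ones q = length (filter (_≟ 1) q)

-- embIdx q r i : all strictly increasing index sequences (indices of r
-- counted starting from i) (j₁ < j₂ < ...) of length |q| with q_t ≤ r_{j_t}.
embIdx : List ℕ → List ℕ → ℕ → List (List ℕ)
embIdx []       _        _ = [] ∷ []
embIdx (x ∷ xs) []       _ = []
embIdx (x ∷ xs) (y ∷ ys) i =
  (if x ≤ᵇ y then map (i ∷_) (embIdx xs ys (suc i)) else [])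
  ++ embIdx (x ∷ xs) ys (suc i)

-- Nontrivial embeddings of q = (q₁,…,q_k) into r: index choices
-- 1 ≤ i₂ < … < i_k ≤ ℓ with q_j ≤ r_{i_j} for 2 ≤ j ≤ k.
nontrivialEmbeddings : List ℕ → List ℕ → List (List ℕ)
nontrivialEmbeddings []       r = []          -- only relevant for b = 0 (A_0 convention)
nontrivialEmbeddings (_ ∷ qs) r = embIdx qs r 1

-- The (q, r) entry of A_b (b ≥ 1); A_0 = (1) by convention.
A : ℕ → List ℕ → List ℕ → ℕ
A zero    _ _ = 1
A (suc _) q r = length (nontrivialEmbeddings q r)
              + (if ⌊ ≡-dec _≟_ q r ⌋ then 1 else 0)

trace : ℕ → ℕ
trace b = sum (map (λ q → A b q q) (compositions b))

-- A composition q has exactly one nontrivial self-embedding for each nonempty weakly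
-- decreasing prefix of q, so tr A_b = C(b) + R(b), where C(b) counts
-- compositions of b and R(b) sums the lengths of their longest weakly decreasing prefixes.
-- Splitting compositions by their first part k and bounding k by a predicate ok, the sum
-- W_ok(b) of 2^o(q) over weakly decreasing compositions satisfies the same recursion as
-- C + R_ok, except that k = 1 is counted twice; that surplus is W_{≤1}(b - 1) = 2^(b-1) = C(b).
-- Hence W_ok = C + R_ok whenever ok admits 1, and taking ok = ⊤ gives the theorem.

module Submission where

open import Defs
open import Algebra.Properties.CommutativeSemigroup using (interchange)
open import Data.Bool using (Bool; true; false; if_then_else_; _∧_)
open import Data.Bool.Properties using (T-≡)
open import Data.List using (List; []; _∷_; _++_; map; concatMap; filter; length; upTo; applyUpTo)
open import Data.List.Properties
  using (map-cong; map-∘; map-++; map-upTo; map-applyUpTo; applyUpTo-∷ʳ; concatMap-cong; concatMap-map;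
         length-map; length-++; ++-identityʳ; ≡-dec)
open import Data.List.Relation.Unary.Linked using (linked?)
open import Data.Nat using (ℕ; zero; suc; _+_; _∸_; _^_; _≤_; _<_; _≤ᵇ_; _≟_; _≤?_; s≤s)
open import Data.Nat.Induction using (<-rec)
open import Data.Nat.ListAction using (sum)
open import Data.Nat.ListAction.Properties using (sum-++)
open import Data.Nat.Properties
  using (+-identityʳ; +-assoc; +-comm; +-commutativeSemigroup; ≤-refl; ≤-trans; m∸n≤m; n<1+n; m<n⇒m<1+n; ≤⇒≤ᵇ)
open import Function using (_∘_; Equivalence)
open import Relation.Binary.PropositionalEquality using (_≡_; refl; sym; trans; cong; cong₂; module ≡-Reasoning)
open import Relation.Nullary using (does)
open import Relation.Nullary.Decidable using (isYes≗does; dec-true)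
open import Relation.Unary using (Decidable)

open ≡-Reasoning

sum-map-++ : ∀ {A : Set} (f : A → ℕ) xs ys → sum (map f (xs ++ ys)) ≡ sum (map f xs) + sum (map f ys)
sum-map-++ f xs ys = trans (cong sum (map-++ f xs ys)) (sum-++ (map f xs) (map f ys))

sum-map-concatMap : ∀ {A B : Set} (f : B → ℕ) (g : A → List B) xs →
                    sum (map f (concatMap g xs)) ≡ sum (map (λ x → sum (map f (g x))) xs)
sum-map-concatMap f g []       = refl
sum-map-concatMap f g (x ∷ xs) =
  trans (sum-map-++ f (g x) (concatMap g xs)) (cong (sum (map f (g x)) +_) (sum-map-concatMap f g xs))

sum-map-cong : ∀ {A : Set} {f g : A → ℕ} → (∀ x → f x ≡ g x) → ∀ xs → sum (map f xs) ≡ sum (map g xs)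
sum-map-cong f≗g xs = cong sum (map-cong f≗g xs)

sum-map-map : ∀ {A B : Set} (f : B → ℕ) (g : A → B) xs → sum (map f (map g xs)) ≡ sum (map (f ∘ g) xs)
sum-map-map f g xs = cong sum (sym (map-∘ xs))

sum-map-+ : ∀ {A : Set} (f g : A → ℕ) xs → sum (map (λ x → f x + g x) xs) ≡ sum (map f xs) + sum (map g xs)
sum-map-+ f g []       = refl
sum-map-+ f g (x ∷ xs) =
  trans (cong (f x + g x +_) (sum-map-+ f g xs)) (interchange +-commutativeSemigroup (f x) (g x) _ _)

sum-map-if : ∀ {A : Set} c (f : A → ℕ) xs →
             sum (map (λ x → if c then f x else 0) xs) ≡ (if c then sum (map f xs) else 0)
sum-map-if true  f xs       = refl
sum-map-if false f []       = refl
sum-map-if false f (x ∷ xs) = sum-map-if false f xs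

sum-map-zero : ∀ {A : Set} (xs : List A) → sum (map (λ _ → 0) xs) ≡ 0
sum-map-zero []       = refl
sum-map-zero (x ∷ xs) = sum-map-zero xs

sum-map-filter : ∀ {A : Set} {P : A → Set} (P? : Decidable P) (f : A → ℕ) xs →
                 sum (map f (filter P? xs)) ≡ sum (map (λ x → if does (P? x) then f x else 0) xs)
sum-map-filter P? f []       = refl
sum-map-filter P? f (x ∷ xs) with does (P? x)
... | true  = cong (f x +_) (sum-map-filter P? f xs)
... | false = sum-map-filter P? f xs

sum-map-upTo-suc : ∀ (f : ℕ → ℕ) m → sum (map f (upTo (suc m))) ≡ f 0 + sum (map (f ∘ suc) (upTo m))
sum-map-upTo-suc f m = cong (λ xs → f 0 + sum xs) (trans (map-applyUpTo suc f m) (sym (map-upTo (f ∘ suc) m)))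

oneTo≡map-suc-upTo : ∀ n → oneTo n ≡ map suc (upTo n)
oneTo≡map-suc-upTo n = trans (oneTo≡applyUpTo n) (sym (map-upTo suc n))
  where
  oneTo≡applyUpTo : ∀ n → oneTo n ≡ applyUpTo suc n
  oneTo≡applyUpTo zero    = refl
  oneTo≡applyUpTo (suc n) = trans (cong (_++ suc n ∷ []) (oneTo≡applyUpTo n)) (applyUpTo-∷ʳ suc n)

concatMap-oneTo-cong : ∀ {A : Set} {g h : ℕ → List A} → (∀ i → g (suc i) ≡ h (suc i)) →
                       ∀ n → concatMap g (oneTo n) ≡ concatMap h (oneTo n)
concatMap-oneTo-cong {g = g} {h} eq n = begin
  concatMap g (oneTo n)          ≡⟨ cong (concatMap g) (oneTo≡map-suc-upTo n) ⟩
  concatMap g (map suc (upTo n)) ≡⟨ concatMap-map g suc (upTo n) ⟩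
  concatMap (g ∘ suc) (upTo n)   ≡⟨ concatMap-cong eq (upTo n) ⟩
  concatMap (h ∘ suc) (upTo n)   ≡⟨ concatMap-map h suc (upTo n) ⟨
  concatMap h (map suc (upTo n)) ≡⟨ cong (concatMap h) (oneTo≡map-suc-upTo n) ⟨
  concatMap h (oneTo n)          ∎

compositionsF-fuel : ∀ {f f′ n} → n ≤ f → n ≤ f′ → compositionsF f n ≡ compositionsF f′ n
compositionsF-fuel {n = zero} _ _ = refl
compositionsF-fuel {suc f} {suc f′} {suc m} (s≤s m≤f) (s≤s m≤f′) =
  concatMap-oneTo-cong
    (λ i → cong (map (suc i ∷_))
                (compositionsF-fuel (≤-trans (m∸n≤m m i) m≤f) (≤-trans (m∸n≤m m i) m≤f′)))
    (suc m)

∑comp : ℕ → (List ℕ → ℕ) → ℕ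
∑comp n g = sum (map g (compositions n))

#compositions : ℕ → ℕ
#compositions n = ∑comp n (λ _ → 1)

∑comp-suc : ∀ m g → ∑comp (suc m) g ≡
            ∑comp m (g ∘ (1 ∷_)) + sum (map (λ i → ∑comp (m ∸ suc i) (g ∘ (2 + i ∷_))) (upTo m))
∑comp-suc m g = begin
  ∑comp (suc m) g
    ≡⟨ sum-map-concatMap g part (oneTo (suc m)) ⟩
  sum (map (λ k → sum (map g (part k))) (oneTo (suc m)))
    ≡⟨ cong (λ ks → sum (map (λ k → sum (map g (part k))) ks)) (oneTo≡map-suc-upTo (suc m)) ⟩
  sum (map (λ k → sum (map g (part k))) (map suc (upTo (suc m))))
    ≡⟨ sum-map-map _ suc (upTo (suc m)) ⟩
  sum (map (λ i → sum (map g (part (suc i)))) (upTo (suc m)))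
    ≡⟨ sum-map-cong firstPart (upTo (suc m)) ⟩
  sum (map (λ i → ∑comp (m ∸ i) (g ∘ (suc i ∷_))) (upTo (suc m)))
    ≡⟨ sum-map-upTo-suc (λ i → ∑comp (m ∸ i) (g ∘ (suc i ∷_))) m ⟩
  ∑comp m (g ∘ (1 ∷_)) + sum (map (λ i → ∑comp (m ∸ suc i) (g ∘ (2 + i ∷_))) (upTo m)) ∎
  where
  part : ℕ → List (List ℕ)
  part k = map (k ∷_) (compositionsF m (suc m ∸ k))

  firstPart : ∀ i → sum (map g (part (suc i))) ≡ ∑comp (m ∸ i) (g ∘ (suc i ∷_))
  firstPart i = trans (sum-map-map g (suc i ∷_) (compositionsF m (m ∸ i)))
                      (cong (sum ∘ map (g ∘ (suc i ∷_))) (compositionsF-fuel {f′ = m ∸ i} (m∸n≤m m i) ≤-refl))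

#compositions-suc-suc : ∀ m → #compositions (2 + m) ≡ #compositions (1 + m) + #compositions (1 + m)
#compositions-suc-suc m = begin
  #compositions (2 + m)
    ≡⟨ ∑comp-suc (suc m) (λ _ → 1) ⟩
  #compositions (1 + m) + sum (map (λ i → #compositions (m ∸ i)) (upTo (suc m)))
    ≡⟨ cong (#compositions (1 + m) +_) (sum-map-upTo-suc (λ i → #compositions (m ∸ i)) m) ⟩
  #compositions (1 + m) + (#compositions m + sum (map (λ i → #compositions (m ∸ suc i)) (upTo m)))
    ≡⟨ cong (#compositions (1 + m) +_) (∑comp-suc m (λ _ → 1)) ⟨
  #compositions (1 + m) + #compositions (1 + m) ∎

decreasing : (ℕ → Bool) → List ℕ → Bool
decreasing ok []       = true
decreasing ok (x ∷ xs) = ok x ∧ decreasing (_≤ᵇ x) xs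

decreasingPrefix : (ℕ → Bool) → List ℕ → ℕ
decreasingPrefix ok []       = 0
decreasingPrefix ok (x ∷ xs) = if ok x then suc (decreasingPrefix (_≤ᵇ x) xs) else 0

weight : (ℕ → Bool) → List ℕ → ℕ
weight ok q = if decreasing ok q then 2 ^ ones q else 0

weightedPartitions : (ℕ → Bool) → ℕ → ℕ
weightedPartitions ok n = ∑comp n (weight ok)

prefixLengths : (ℕ → Bool) → ℕ → ℕ
prefixLengths ok n = ∑comp n (decreasingPrefix ok)

weight-1∷ : ∀ {ok} → ok 1 ≡ true → ∀ q → weight ok (1 ∷ q) ≡ weight (_≤ᵇ 1) q + weight (_≤ᵇ 1) q
weight-1∷ ok1 q rewrite ok1 with decreasing (_≤ᵇ 1) q
... | true  = cong (2 ^ ones q +_) (+-identityʳ (2 ^ ones q))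
... | false = refl

weight-2+∷ : ∀ ok i q → weight ok (2 + i ∷ q) ≡ (if ok (2 + i) then weight (_≤ᵇ 2 + i) q else 0)
weight-2+∷ ok i q with ok (2 + i)
... | true  = refl
... | false = refl

decreasingPrefix-1∷ : ∀ {ok} → ok 1 ≡ true → ∀ q →
                      decreasingPrefix ok (1 ∷ q) ≡ suc (decreasingPrefix (_≤ᵇ 1) q)
decreasingPrefix-1∷ ok1 q rewrite ok1 = refl

weightedPartitions-suc :
  ∀ {ok} → ok 1 ≡ true → ∀ m →
  weightedPartitions ok (suc m) ≡
  (weightedPartitions (_≤ᵇ 1) m + weightedPartitions (_≤ᵇ 1) m)
  + sum (map (λ i → if ok (2 + i) then weightedPartitions (_≤ᵇ 2 + i) (m ∸ suc i) else 0) (upTo m))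
weightedPartitions-suc {ok} ok1 m =
  trans (∑comp-suc m (weight ok))
        (cong₂ _+_ (trans (sum-map-cong (weight-1∷ {ok} ok1) (compositions m))
                          (sum-map-+ (weight (_≤ᵇ 1)) (weight (_≤ᵇ 1)) (compositions m)))
                   (sum-map-cong (λ i → trans (sum-map-cong (weight-2+∷ ok i) (compositions (m ∸ suc i)))
                                              (sum-map-if (ok (2 + i)) (weight (_≤ᵇ 2 + i)) (compositions (m ∸ suc i))))
                                 (upTo m)))

prefixLengths-suc :
  ∀ {ok} → ok 1 ≡ true → ∀ m →
  prefixLengths ok (suc m) ≡
  (#compositions m + prefixLengths (_≤ᵇ 1) m)
  + sum (map (λ i → if ok (2 + i) then #compositions (m ∸ suc i) + prefixLengths (_≤ᵇ 2 + i) (m ∸ suc i) else 0)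
             (upTo m))
prefixLengths-suc {ok} ok1 m =
  trans (∑comp-suc m (decreasingPrefix ok))
        (cong₂ _+_ (trans (sum-map-cong (decreasingPrefix-1∷ {ok} ok1) (compositions m))
                          (sum-map-+ (λ _ → 1) (decreasingPrefix (_≤ᵇ 1)) (compositions m)))
                   (sum-map-cong firstPart (upTo m)))
  where
  firstPart : ∀ i → ∑comp (m ∸ suc i) (decreasingPrefix ok ∘ (2 + i ∷_)) ≡
                    (if ok (2 + i) then #compositions (m ∸ suc i) + prefixLengths (_≤ᵇ 2 + i) (m ∸ suc i) else 0)
  firstPart i =
    trans (sum-map-if (ok (2 + i)) (suc ∘ decreasingPrefix (_≤ᵇ 2 + i)) (compositions (m ∸ suc i)))
          (cong (λ s → if ok (2 + i) then s else 0)
                (sum-map-+ (λ _ → 1) (decreasingPrefix (_≤ᵇ 2 + i)) (compositions (m ∸ suc i))))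

weightedPartitions-≤1 : ∀ m → weightedPartitions (_≤ᵇ 1) m ≡ #compositions (suc m)
weightedPartitions-≤1 zero    = refl
weightedPartitions-≤1 (suc m) = begin
  weightedPartitions (_≤ᵇ 1) (suc m)
    ≡⟨ weightedPartitions-suc refl m ⟩
  (weightedPartitions (_≤ᵇ 1) m + weightedPartitions (_≤ᵇ 1) m) + sum (map (λ _ → 0) (upTo m))
    ≡⟨ cong₂ _+_ (cong₂ _+_ (weightedPartitions-≤1 m) (weightedPartitions-≤1 m)) (sum-map-zero (upTo m)) ⟩
  (#compositions (suc m) + #compositions (suc m)) + 0
    ≡⟨ +-identityʳ _ ⟩
  #compositions (suc m) + #compositions (suc m)
    ≡⟨ #compositions-suc-suc m ⟨
  #compositions (suc (suc m)) ∎

weightedPartitions≡#compositions+prefixLengths :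
  ∀ n {ok} → ok 1 ≡ true → weightedPartitions ok n ≡ #compositions n + prefixLengths ok n
weightedPartitions≡#compositions+prefixLengths = <-rec _ λ where
  zero    _  _ → refl
  (suc m) ih {ok} ok1 →
    let W = weightedPartitions
        ΣW = sum (map (λ i → if ok (2 + i) then W (_≤ᵇ 2 + i) (m ∸ suc i) else 0) (upTo m))
        ΣCR = sum (map (λ i → if ok (2 + i) then #compositions (m ∸ suc i) + prefixLengths (_≤ᵇ 2 + i) (m ∸ suc i) else 0)
                       (upTo m))
    in begin
    W ok (suc m)
      ≡⟨ weightedPartitions-suc ok1 m ⟩
    (W (_≤ᵇ 1) m + W (_≤ᵇ 1) m) + ΣW
      ≡⟨ cong₂ _+_ (cong (W (_≤ᵇ 1) m +_) (ih (n<1+n m) refl))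
                   (sum-map-cong (λ i → cong (λ s → if ok (2 + i) then s else 0) (ih (s≤s (m∸n≤m m (suc i))) refl))
                                 (upTo m)) ⟩
    (W (_≤ᵇ 1) m + (#compositions m + prefixLengths (_≤ᵇ 1) m)) + ΣCR
      ≡⟨ +-assoc (W (_≤ᵇ 1) m) _ ΣCR ⟩
    W (_≤ᵇ 1) m + ((#compositions m + prefixLengths (_≤ᵇ 1) m) + ΣCR)
      ≡⟨ cong₂ _+_ (weightedPartitions-≤1 m) (sym (prefixLengths-suc ok1 m)) ⟩
    #compositions (suc m) + prefixLengths ok (suc m) ∎

≤ᵇ-refl : ∀ n → (n ≤ᵇ n) ≡ true
≤ᵇ-refl n = Equivalence.to T-≡ (≤⇒≤ᵇ (≤-refl {n}))

embIdx-long : ∀ q r i → length r < length q → embIdx q r i ≡ []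
embIdx-long (x ∷ xs) []       i _ = refl
embIdx-long (x ∷ xs) (y ∷ ys) i (s≤s r<q)
  rewrite embIdx-long xs ys (suc i) r<q | embIdx-long (x ∷ xs) ys (suc i) (m<n⇒m<1+n r<q)
  with x ≤ᵇ y
... | true  = refl
... | false = refl

length-embIdx-self : ∀ q i → length (embIdx q q i) ≡ 1
length-embIdx-self []       i = refl
length-embIdx-self (y ∷ ys) i
  rewrite ≤ᵇ-refl y | embIdx-long (y ∷ ys) ys (suc i) ≤-refl | ++-identityʳ (map (i ∷_) (embIdx ys ys (suc i)))
  = trans (length-map (i ∷_) (embIdx ys ys (suc i))) (length-embIdx-self ys (suc i))

-- An embedding of xs into x ∷ xs either skips x, and is then the identity, or sends the
-- head y of xs to x (allowed iff y ≤ x) and continues as an embedding of the tail into xs.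
length-embIdx-tail : ∀ x xs i → length (embIdx xs (x ∷ xs) i) ≡ suc (decreasingPrefix (_≤ᵇ x) xs)
length-embIdx-tail x []       i = refl
length-embIdx-tail x (y ∷ ys) i with y ≤ᵇ x
... | false = length-embIdx-self (y ∷ ys) (suc i)
... | true  = begin
  length (map (i ∷_) (embIdx ys (y ∷ ys) (suc i)) ++ embIdx (y ∷ ys) (y ∷ ys) (suc i))
    ≡⟨ length-++ (map (i ∷_) (embIdx ys (y ∷ ys) (suc i))) ⟩
  length (map (i ∷_) (embIdx ys (y ∷ ys) (suc i))) + length (embIdx (y ∷ ys) (y ∷ ys) (suc i))
    ≡⟨ cong₂ _+_ (trans (length-map (i ∷_) (embIdx ys (y ∷ ys) (suc i))) (length-embIdx-tail y ys (suc i)))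
                 (length-embIdx-self (y ∷ ys) (suc i)) ⟩
  suc (decreasingPrefix (_≤ᵇ y) ys) + 1
    ≡⟨ +-comm _ 1 ⟩
  suc (suc (decreasingPrefix (_≤ᵇ y) ys)) ∎

A-diagonal : ∀ b q → A (suc b) q q ≡ suc (decreasingPrefix (λ _ → true) q)
A-diagonal b q =
  trans (cong (λ c → length (nontrivialEmbeddings q q) + (if c then 1 else 0))
              (trans (isYes≗does (≡-dec _≟_ q q)) (dec-true (≡-dec _≟_ q q) refl)))
        (nontrivial q)
  where
  nontrivial : ∀ q → length (nontrivialEmbeddings q q) + 1 ≡ suc (decreasingPrefix (λ _ → true) q)
  nontrivial []       = refl
  nontrivial (x ∷ xs) = trans (cong (_+ 1) (length-embIdx-tail x xs 1)) (+-comm _ 1)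

linked?-decreasing : ∀ x xs → does (linked? (λ a b → b ≤? a) (x ∷ xs)) ≡ decreasing (_≤ᵇ x) xs
linked?-decreasing x []       = refl
linked?-decreasing x (y ∷ ys) = cong ((y ≤ᵇ x) ∧_) (linked?-decreasing y ys)

sum-partitions : ∀ n → sum (map (λ q → 2 ^ ones q) (partitions n)) ≡ weightedPartitions (λ _ → true) n
sum-partitions n = trans (sum-map-filter (linked? (λ a b → b ≤? a)) (λ q → 2 ^ ones q) (compositions n))
                         (sum-map-cong isPartition (compositions n))
  where
  isPartition : ∀ q → (if does (linked? (λ a b → b ≤? a) q) then 2 ^ ones q else 0) ≡ weight (λ _ → true) q
  isPartition []       = refl
  isPartition (x ∷ xs) = cong (λ c → if c then 2 ^ ones (x ∷ xs) else 0) (linked?-decreasing x xs)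

theorem11 : (b : ℕ) → trace b ≡ sum (map (λ q → 2 ^ ones q) (partitions b))
theorem11 zero    = refl
theorem11 (suc m) = begin
  trace (suc m)
    ≡⟨ sum-map-cong (A-diagonal m) (compositions (suc m)) ⟩
  ∑comp (suc m) (suc ∘ decreasingPrefix (λ _ → true))
    ≡⟨ sum-map-+ (λ _ → 1) (decreasingPrefix (λ _ → true)) (compositions (suc m)) ⟩
  #compositions (suc m) + prefixLengths (λ _ → true) (suc m)
    ≡⟨ weightedPartitions≡#compositions+prefixLengths (suc m) refl ⟨
  weightedPartitions (λ _ → true) (suc m)
    ≡⟨ sum-partitions (suc m) ⟨
  sum (map (λ q → 2 ^ ones q) (partitions (suc m))) ∎
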